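{- Let $\phi_{\mathrm{xor}}$ be a satisfiable conjunction of xor-constraints and let $\langle \mathcal{E},\tau\rangle$ be a consistent, propagation saturated assigned tableau for $\phi_{\mathrm{xor}}$. Then for every variable $y$ and every $v_y\in\mathbb{B}$, it holds that $\phi_{\mathrm{xor}} \land \bigwedge_{(x \mapsto v_x) \in \tau}(x \equiv v_x) \models (y \equiv v_y)$ if and only if $\tau(y) = v_y$ (in particular $\tau(y)$ is defined).
   Context: Truth values are $\mathbb{B}=\{\bot,\top\}$. An xor-constraint is an equation $x_1 \oplus \dots \oplus x_k \equiv p$ with Boolean variables $x_i$ and parity $p\in\mathbb{B}$ (duplicate variables cancel in pairs). A truth assignment $\tau$ (a possibly partial function from variables to $\mathbb{B}$) satisfies it if $\tau(x_1)\oplus\dots\oplus\tau(x_k)=p$. A tableau for a satisfiable conjunction $\phi_{\mathrm{xor}}$ of xor-constraints is a set $\mathcal{E}$ of equations of the form $x_i := x_{i,1}\oplus\dots\oplus x_{i,k_i}\oplus p_i$, where $x_i,x_{i,1},\dots,x_{i,k_i}$ are distinct variables of $\phi_{\mathrm{xor}}$ and $p_i\in\mathbb{B}$, such that: (1) each variable occurs at most once as a left-hand side variable; (2) a variable occurring as a left-hand side variable does not occur in any right-hand side; (3) the conjunction of the xor-constraints $x_i\oplus x_{i,1}\oplus\dots\oplus x_{i,k_i}\equiv p_i$ over all equations of $\mathcal{E}$ is logically equivalent to $\phi_{\mathrm{xor}}$. An assigned tableau for $\phi_{\mathrm{xor}}$ is a pair $\langle\mathcal{E},\tau\rangle$ where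 $\mathcal{E}$ is a tableau for $\phi_{\mathrm{xor}}$ and $\tau$ is a possibly partial truth assignment on the variables of $\phi_{\mathrm{xor}}$. It is propagation saturated if for every equation $x_i := x_{i,1}\oplus\dots\oplus x_{i,k_i}\oplus p_i$, $\tau(x_i)$ is defined iff $\tau$ is defined on all of $x_{i,1},\dots,x_{i,k_i}$. It is consistent if there is no equation with $\tau$ defined on all of $x_i,x_{i,1},\dots,x_{i,k_i}$ and $\tau(x_i)\neq \tau(x_{i,1})\oplus\dots\oplus\tau(x_{i,k_i})\oplus p_i$. -}

module Defs where

open import Data.Bool using (Bool; true; false; _xor_)
open import Data.Fin using (Fin)
open import Data.List using (List; []; _∷_; map)
open import Data.List.Membership.Propositional using (_∈_; _∉_)
open import Data.List.Relation.Unary.All using (All)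
open import Data.List.Relation.Unary.Unique.Propositional using (Unique)
open import Data.Maybe using (Maybe; just; nothing; Is-just)
open import Data.Nat using (ℕ)
open import Data.Product using (Σ; _×_; _,_)
open import Function.Bundles using (_⇔_)
open import Relation.Binary.PropositionalEquality using (_≡_)

Assignment : ℕ → Set
Assignment n = Fin n → Bool

PAssignment : ℕ → Set
PAssignment n = Fin n → Maybe Bool

-- An xor-constraint x₁ ⊕ … ⊕ xₖ ≡ p (duplicates cancel automatically under xor).
record XorConstraint (n : ℕ) : Set where
  constructor _≡ₓ_
  field
    vars   : List (Fin n)
    parity : Bool
open XorConstraint public

evalXor : ∀ {n} → Assignment n → List (Fin n) → Bool
evalXor σ []       = false
evalXor σ (x ∷ xs) = σ x xor evalXor σ xs

evalXorP : ∀ {n} → PAssignment n → List (Fin n) → Maybe Bool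
evalXorP τ []       = just false
evalXorP τ (x ∷ xs) with τ x | evalXorP τ xs
... | just a  | just b = just (a xor b)
... | _       | _      = nothing

_⊨c_ : ∀ {n} → Assignment n → XorConstraint n → Set
σ ⊨c c = evalXor σ (vars c) ≡ parity c

Formula : ℕ → Set
Formula n = List (XorConstraint n)

_⊨_ : ∀ {n} → Assignment n → Formula n → Set
σ ⊨ φ = All (σ ⊨c_) φ

Satisfiable : ∀ {n} → Formula n → Set
Satisfiable {n} φ = Σ (Assignment n) λ σ → σ ⊨ φ

record Equation (n : ℕ) : Set where
  constructor _:=_⊕_
  field
    lhs : Fin n
    rhs : List (Fin n)
    par : Bool
open Equation public

eqConstraint : ∀ {n} → Equation n → XorConstraint n
eqConstraint e = (lhs e ∷ rhs e) ≡ₓ par e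

Tableau : ℕ → Set
Tableau n = List (Equation n)

record IsTableau {n : ℕ} (φ : Formula n) (E : Tableau n) : Set where
  field
    distinct  : ∀ {e} → e ∈ E → Unique (lhs e ∷ rhs e)
    lhsUnique : Unique (map lhs E)
    lhsNotRhs : ∀ {e e′} → e ∈ E → e′ ∈ E → lhs e ∉ rhs e′
    equiv     : ∀ (σ : Assignment n) → (σ ⊨ φ) ⇔ (σ ⊨ map eqConstraint E)

PropagationSaturated : ∀ {n} → Tableau n → PAssignment n → Set
PropagationSaturated E τ =
  ∀ {e} → e ∈ E → Is-just (τ (lhs e)) ⇔ All (λ x → Is-just (τ x)) (rhs e)

Consistent : ∀ {n} → Tableau n → PAssignment n → Set
Consistent E τ =
  ∀ {e} → e ∈ E → ∀ (b : Bool) → evalXorP τ (lhs e ∷ rhs e) ≡ just b → b ≡ par e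

Agrees : ∀ {n} → Assignment n → PAssignment n → Set
Agrees {n} σ τ = ∀ (x : Fin n) (v : Bool) → τ x ≡ just v → σ x ≡ v

Entails : ∀ {n} → Formula n → PAssignment n → Fin n → Bool → Set
Entails {n} φ τ y vy = ∀ (σ : Assignment n) → σ ⊨ φ → Agrees σ τ → σ y ≡ vy

-- Fix values for all variables that are not left-hand sides of the tableau and
-- compute the left-hand sides from their equations: this always yields a model
-- of φ_xor, and if the fixed values extend τ, so does the model, by consistency
-- and saturation.  Hence an assigned variable is entailed to equal its value.
-- For an unassigned y, flip a single unassigned variable z: either y itself
-- (if it is not a left-hand side) or, by saturation, some unassigned variable
-- on the right-hand side of y's equation.  The two resulting models extend τ
-- and disagree on y, so no value of y is entailed.
module Submission where

open import Defs
open import Data.Bool using (Bool; true; false; _xor_; not)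
open import Data.Bool.Properties using (not-¬; not-distribˡ-xor; not-distribʳ-xor)
open import Data.Empty using (⊥-elim)
open import Data.Fin using (Fin; _≟_)
open import Data.List using ([]; _∷_; map)
open import Data.List.Membership.Propositional using (_∈_; _∉_; find)
open import Data.List.Membership.Propositional.Properties using (∈-map⁺; ∈-map⁻)
import Data.List.Membership.DecPropositional as DecMembership
open import Data.List.Relation.Unary.All as All using (All; []; _∷_)
open import Data.List.Relation.Unary.All.Properties using (map⁺; ¬All⇒Any¬)
open import Data.List.Relation.Unary.Any using (here; there)
open import Data.List.Relation.Unary.Unique.Propositional using (Unique; _∷_)
open import Data.Maybe using (just; nothing; Is-just; fromMaybe)
import Data.Maybe.Relation.Unary.Any as Maybe
open import Data.Nat using (ℕ)
open import Data.Product using (Σ-syntax; _×_; _,_)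
open import Data.Unit using (tt)
open import Function.Base using (_∘_; case_of_)
open import Function.Bundles using (_⇔_; mk⇔; Equivalence)
open import Relation.Nullary using (¬_; Dec; yes; no)
open import Relation.Binary.PropositionalEquality
  using (_≡_; _≢_; refl; sym; trans; cong; cong₂; subst; module ≡-Reasoning)

private
  variable
    n : ℕ

xor≡⇒≡xor : ∀ a b {c} → a xor b ≡ c → a ≡ b xor c
xor≡⇒≡xor false false refl = refl
xor≡⇒≡xor false true  refl = refl
xor≡⇒≡xor true  false refl = refl
xor≡⇒≡xor true  true  refl = refl

≡xor⇒xor≡ : ∀ {a} b c → a ≡ b xor c → a xor b ≡ c
≡xor⇒xor≡ false false refl = refl
≡xor⇒xor≡ false true  refl = refl
≡xor⇒xor≡ true  false refl = refl
≡xor⇒xor≡ true  true  refl = refl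

evalXor-cong : ∀ {σ σ′ : Assignment n} {xs} →
               (∀ {x} → x ∈ xs → σ x ≡ σ′ x) → evalXor σ xs ≡ evalXor σ′ xs
evalXor-cong {xs = []}     eq = refl
evalXor-cong {xs = x ∷ xs} eq = cong₂ _xor_ (eq (here refl)) (evalXor-cong (eq ∘ there))

flipAt : Fin n → Assignment n → Assignment n
flipAt z β x with x ≟ z
... | yes _ = not (β x)
... | no  _ = β x

flipAt-≡ : ∀ z (β : Assignment n) → flipAt z β z ≡ not (β z)
flipAt-≡ z β with z ≟ z
... | yes _   = refl
... | no  z≢z = ⊥-elim (z≢z refl)

flipAt-≢ : ∀ {z x} (β : Assignment n) → x ≢ z → flipAt z β x ≡ β x
flipAt-≢ {z = z} {x} β x≢z with x ≟ z
... | yes x≡z = ⊥-elim (x≢z x≡z)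
... | no  _   = refl

evalXor-flipAt : ∀ {z} (β : Assignment n) {xs} → Unique xs → z ∈ xs →
                 evalXor (flipAt z β) xs ≡ not (evalXor β xs)
evalXor-flipAt {z = z} β {z ∷ xs} (z∉xs ∷ _) (here refl) =
  trans (cong₂ _xor_ (flipAt-≡ z β) unchanged) (sym (not-distribˡ-xor (β z) (evalXor β xs)))
  where
  unchanged : evalXor (flipAt z β) xs ≡ evalXor β xs
  unchanged = evalXor-cong λ x∈ → flipAt-≢ β λ x≡z → All.lookup z∉xs x∈ (sym x≡z)
evalXor-flipAt β {x ∷ xs} (x∉xs ∷ xs!) (there z∈) =
  trans (cong₂ _xor_ (flipAt-≢ β λ { refl → All.lookup x∉xs z∈ refl }) (evalXor-flipAt β xs! z∈))
        (sym (not-distribʳ-xor (β x) (evalXor β xs)))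

complete : PAssignment n → Assignment n
complete τ x = fromMaybe false (τ x)

complete-agrees : (τ : PAssignment n) → Agrees (complete τ) τ
complete-agrees τ x v τx rewrite τx = refl

flipAt-agrees : ∀ {z} {β : Assignment n} {τ} → ¬ Is-just (τ z) → Agrees β τ →
                Agrees (flipAt z β) τ
flipAt-agrees {β = β} z-free agree x v τx =
  trans (flipAt-≢ β λ { refl → z-free (subst Is-just (sym τx) (Maybe.just tt)) }) (agree x v τx)

agrees-just : ∀ {β : Assignment n} {τ} → Agrees β τ → ∀ {x} → Is-just (τ x) →
              τ x ≡ just (β x)
agrees-just {τ = τ} agree {x} _ with τ x in τx
... | just v = cong just (sym (agree x v τx))

evalXorP-agrees : ∀ {β : Assignment n} {τ} → Agrees β τ → ∀ {xs} →
                  All (Is-just ∘ τ) xs → evalXorP τ xs ≡ just (evalXor β xs)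
evalXorP-agrees agree []              = refl
evalXorP-agrees agree (defined ∷ rest)
  rewrite agrees-just agree defined | evalXorP-agrees agree rest = refl

extend : Tableau n → Assignment n → Assignment n
extend []      β x = β x
extend (e ∷ E) β x with lhs e ≟ x
... | yes _ = evalXor β (rhs e) xor par e
... | no  _ = extend E β x

extend-∉ : ∀ (E : Tableau n) β {x} → x ∉ map lhs E → extend E β x ≡ β x
extend-∉ []      β x∉ = refl
extend-∉ (e ∷ E) β {x} x∉ with lhs e ≟ x
... | yes refl = ⊥-elim (x∉ (here refl))
... | no  _    = extend-∉ E β (x∉ ∘ there)

extend-lhs : ∀ {E : Tableau n} β → Unique (map lhs E) → ∀ {e} → e ∈ E →
             extend E β (lhs e) ≡ evalXor β (rhs e) xor par e
extend-lhs {E = e ∷ E} β _ (here refl) with lhs e ≟ lhs e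
... | yes _   = refl
... | no  e≢e = ⊥-elim (e≢e refl)
extend-lhs {E = e′ ∷ E} β (e′∉E ∷ E!) {e} (there e∈) with lhs e′ ≟ lhs e
... | yes e′≡e = ⊥-elim (All.lookup e′∉E (∈-map⁺ lhs e∈) e′≡e)
... | no  _    = extend-lhs β E! e∈

module AssignedTableau {φ : Formula n} {E : Tableau n} {τ : PAssignment n}
  (tableau : IsTableau φ E) (consistent : Consistent E τ) (saturated : PropagationSaturated E τ)
  where
  open IsTableau tableau
  open DecMembership (_≟_ {n}) using (_∈?_)

  rhs-∉-lhs : ∀ {e x} → e ∈ E → x ∈ rhs e → x ∉ map lhs E
  rhs-∉-lhs e∈ x∈ x∈lhs with ∈-map⁻ lhs x∈lhs
  ... | e′ , e′∈ , refl = lhsNotRhs e′∈ e∈ x∈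

  extend-⊨ : ∀ β → extend E β ⊨ φ
  extend-⊨ β = Equivalence.from (equiv (extend E β)) (map⁺ (All.tabulate satisfied))
    where
    satisfied : ∀ {e} → e ∈ E → extend E β ⊨c eqConstraint e
    satisfied e∈ = ≡xor⇒xor≡ _ _ (trans (extend-lhs β lhsUnique e∈)
      (cong (_xor _) (sym (evalXor-cong λ x∈ → extend-∉ E β (rhs-∉-lhs e∈ x∈)))))

  extend-agrees : ∀ {β} → Agrees β τ → Agrees (extend E β) τ
  extend-agrees {β} agree x v τx with x ∈? map lhs E
  ... | no x∉ = trans (extend-∉ E β x∉) (agree x v τx)
  ... | yes x∈ with ∈-map⁻ lhs x∈
  ... | e , e∈ , refl =
    trans (extend-lhs β lhsUnique e∈) (sym (xor≡⇒≡xor v _ (consistent e∈ _ fully-assigned)))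
    where
    lhs-defined : Is-just (τ (lhs e))
    lhs-defined = subst Is-just (sym τx) (Maybe.just tt)
    fully-assigned : evalXorP τ (lhs e ∷ rhs e) ≡ just (v xor evalXor β (rhs e))
    fully-assigned =
      trans (evalXorP-agrees agree (lhs-defined ∷ Equivalence.to (saturated e∈) lhs-defined))
            (cong (λ b → just (b xor evalXor β (rhs e))) (agree (lhs e) v τx))

  Model : Assignment n → Set
  Model σ = σ ⊨ φ × Agrees σ τ

  extend-model : ∀ {β} → Agrees β τ → Model (extend E β)
  extend-model agree = extend-⊨ _ , extend-agrees agree

  rhs-unique : ∀ {e} → e ∈ E → Unique (rhs e)
  rhs-unique e∈ with distinct e∈
  ... | _ ∷ rhs! = rhs!

  unassigned-rhs : ∀ {e} → e ∈ E → ¬ Is-just (τ (lhs e)) →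
                   Σ[ z ∈ Fin n ] z ∈ rhs e × ¬ Is-just (τ z)
  unassigned-rhs {e} e∈ lhs-free =
    find (¬All⇒Any¬ is-just? (rhs e) (lhs-free ∘ Equivalence.from (saturated e∈)))
    where
    is-just? : ∀ x → Dec (Is-just (τ x))
    is-just? x = Maybe.dec (λ _ → yes tt) (τ x)

  flip-unassigned : ∀ β {y} → ¬ Is-just (τ y) →
                    Σ[ z ∈ Fin n ] ¬ Is-just (τ z) × extend E (flipAt z β) y ≡ not (extend E β y)
  flip-unassigned β {y} y-free with y ∈? map lhs E
  ... | no y∉ = y , y-free ,
    trans (extend-∉ E _ y∉) (trans (flipAt-≡ y β) (cong not (sym (extend-∉ E β y∉))))
  ... | yes y∈ with ∈-map⁻ lhs y∈
  ... | e , e∈ , refl with unassigned-rhs e∈ y-free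
  ... | z , z∈ , z-free = z , z-free , (begin
    extend E (flipAt z β) (lhs e)          ≡⟨ extend-lhs _ lhsUnique e∈ ⟩
    evalXor (flipAt z β) (rhs e) xor par e ≡⟨ cong (_xor par e) (evalXor-flipAt β (rhs-unique e∈) z∈) ⟩
    not (evalXor β (rhs e)) xor par e      ≡⟨ sym (not-distribˡ-xor (evalXor β (rhs e)) (par e)) ⟩
    not (evalXor β (rhs e) xor par e)      ≡⟨ cong not (sym (extend-lhs β lhsUnique e∈)) ⟩
    not (extend E β (lhs e))               ∎)
    where open ≡-Reasoning

  entailed-value : ∀ {y v vy} → τ y ≡ just v → Entails φ τ y vy → v ≡ vy
  entailed-value {y} {v} τy entails with extend-model (complete-agrees τ)
  ... | ⊨φ , agree = trans (sym (agree y v τy)) (entails _ ⊨φ agree)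

  unassigned-not-entailed : ∀ {y vy} → ¬ Is-just (τ y) → ¬ Entails φ τ y vy
  unassigned-not-entailed {y} y-free entails
    with flip-unassigned (complete τ) y-free
  ... | z , z-free , flipped
    with extend-model (complete-agrees τ) | extend-model (flipAt-agrees z-free (complete-agrees τ))
  ... | ⊨φ₀ , agree₀ | ⊨φ₁ , agree₁ =
    not-¬ (sym (entails _ ⊨φ₀ agree₀)) (trans (sym (entails _ ⊨φ₁ agree₁)) flipped)

lemma2 : ∀ (n : ℕ) (φ : Formula n) → Satisfiable φ →
    ∀ (E : Tableau n) (τ : PAssignment n) → IsTableau φ E →
    Consistent E τ → PropagationSaturated E τ →
    ∀ (y : Fin n) (vy : Bool) → Entails φ τ y vy ⇔ (τ y ≡ just vy)
lemma2 n φ _ E τ tableau consistent saturated y vy = mk⇔ entailed⇒assigned assigned⇒entailed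
  where
  open AssignedTableau tableau consistent saturated

  assigned⇒entailed : τ y ≡ just vy → Entails φ τ y vy
  assigned⇒entailed τy _ _ agree = agree y vy τy

  entailed⇒assigned : Entails φ τ y vy → τ y ≡ just vy
  entailed⇒assigned entails with τ y in τy
  ... | just v  = cong just (entailed-value τy entails)
  ... | nothing = ⊥-elim (unassigned-not-entailed unassigned entails)
    where
    unassigned : ¬ Is-just (τ y)
    unassigned defined = case subst Is-just τy defined of λ ()
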